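{- Let $A$ be an online algorithm and $B$ an algorithm (online or offline) for the $k$-server problem, and let $n\ge 1$. Suppose there exist $c>1$, $d>0$ and a bijection $\pi:\mathcal{I}_n\to\mathcal{I}_n$ such that for all $\sigma\in\mathcal{I}_n$ and all $i\le n$: (i) $A(\sigma[i]\mid B(\sigma[1,i-1]))\le d\cdot B(\sigma[i])$, and (ii) $A(\sigma[i])-A(\pi(\sigma)[i]\mid B(\pi(\sigma)[1,i-1]))\le (c-d)\cdot B(\pi(\sigma)[i])$. Then $A(\sigma)\le c\cdot B(\pi(\sigma))$ for all $\sigma\in\mathcal{I}_n$.
   Context: $\mathcal{I}_n$ is the set of all request sequences of length $n$ over the (finite, discretized) metric; $\sigma[i]$ is the $i$-th request and $\sigma[1,i]$ the prefix of length $i$. $A(\sigma)$ is the total cost of $A$ on $\sigma$. $B(\sigma[i])$ (resp. $A(\sigma[i])$) denotes the cost incurred by $B$ (resp. $A$) on the $i$-th request when running on $\sigma$. $A(\sigma[i]\mid B(\sigma[1,i-1]))$ denotes the cost $A$ would incur to serve request $\sigma[i]$ when starting from the server configuration that $B$ has after serving $\sigma[1,i-1]$ (if $B$ is offline, its decisions on the prefix are those it makes when processing the whole sequence). -}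

module Defs where

open import Data.Nat using (ℕ; zero; suc)
open import Data.Fin using (Fin; zero; suc; inject₁; toℕ)
open import Data.Vec using (Vec; []; _∷_; lookup; toList)
open import Data.Vec.Membership.Propositional using (_∈_)
open import Data.List using (List; []; _∷_; _++_; [_]; take)
open import Data.Rational using (ℚ; 0ℚ; _+_; _≤_)
open import Relation.Binary.PropositionalEquality using (_≡_)

record FiniteMetric (m : ℕ) : Set where
  field
    dist      : Fin m → Fin m → ℚ
    nonneg    : ∀ x y → 0ℚ ≤ dist x y
    zero-self : ∀ x → dist x x ≡ 0ℚ
    zero-eq   : ∀ x y → dist x y ≡ 0ℚ → x ≡ y
    symmetric : ∀ x y → dist x y ≡ dist y x
    triangle  : ∀ x y z → dist x z ≤ dist x y + dist y z

sumFin : ∀ {n} → (Fin n → ℚ) → ℚ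
sumFin {zero}  f = 0ℚ
sumFin {suc n} f = f zero + sumFin (λ i → f (suc i))

module KServer {m : ℕ} (M : FiniteMetric m) (k : ℕ) (C₀ : Vec (Fin m) k) where
  open FiniteMetric M

  -- a configuration: positions of the k (labelled) servers
  Config : Set
  Config = Vec (Fin m) k

  -- a request is a point; 𝓘ₙ = request sequences of length n
  Req : Set
  Req = Fin m

  Inst : ℕ → Set
  Inst n = Vec Req n

  moveCost : ∀ {j} → Vec (Fin m) j → Vec (Fin m) j → ℚ
  moveCost []       []        = 0ℚ
  moveCost (x ∷ xs) (y ∷ ys)  = dist x y + moveCost xs ys

  -- prefix σ[1,i-1] (the requests strictly before the 0-indexed request i)
  prefix : ∀ {n} → Inst n → Fin n → List Req
  prefix σ i = take (toℕ i) (toList σ)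

  -- A general (online or offline) algorithm: on input σ it produces the
  -- sequence of configurations conf σ 0 = C₀, conf σ (i+1) = configuration
  -- after serving σ[i]; each request must be covered after it is served.
  record Algorithm : Set where
    field
      conf   : ∀ {n} → Inst n → Fin (suc n) → Config
      start  : ∀ {n} (σ : Inst n) → conf σ zero ≡ C₀
      serves : ∀ {n} (σ : Inst n) (i : Fin n) → lookup σ i ∈ conf σ (suc i)

  reqCost : Algorithm → ∀ {n} → Inst n → Fin n → ℚ
  reqCost B σ i = moveCost (Algorithm.conf B σ (inject₁ i)) (Algorithm.conf B σ (suc i))

  totalCost : Algorithm → ∀ {n} → Inst n → ℚ
  totalCost B σ = sumFin (reqCost B σ)

  record OnlineAlgorithm : Set where
    field
      step   : List Req → Config → Req → Config
      serves : ∀ h C r → r ∈ step h C r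

    trajectory : ∀ {n} → List Req → Config → Inst n → Vec Config (suc n)
    trajectory h C []       = C ∷ []
    trajectory h C (r ∷ rs) = C ∷ trajectory (h ++ [ r ]) (step h C r) rs

    -- A(σ[i] | C): cost A incurs to serve σ[i] starting from configuration C
    condCost : ∀ {n} → Inst n → Fin n → Config → ℚ
    condCost σ i C = moveCost C (step (prefix σ i) C (lookup σ i))

  onlineConf : OnlineAlgorithm → ∀ {n} → Inst n → Fin (suc n) → Config
  onlineConf A σ j = lookup (OnlineAlgorithm.trajectory A [] C₀ σ) j

  onlineReqCost : OnlineAlgorithm → ∀ {n} → Inst n → Fin n → ℚ
  onlineReqCost A σ i = moveCost (onlineConf A σ (inject₁ i)) (onlineConf A σ (suc i))

  onlineTotalCost : OnlineAlgorithm → ∀ {n} → Inst n → ℚ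
  onlineTotalCost A σ = sumFin (onlineReqCost A σ)

  -- B's configuration after σ[1,i-1], i.e. before serving σ[i]
  confBefore : Algorithm → ∀ {n} → Inst n → Fin n → Config
  confBefore B σ i = Algorithm.conf B σ (inject₁ i)

  onlineCondCost : OnlineAlgorithm → ∀ {n} → Inst n → Fin n → Config → ℚ
  onlineCondCost A = OnlineAlgorithm.condCost A

module Submission where

-- The bound is proved request by request and then summed.
-- For a fixed σ and request i, write τ = π(σ).  Hypothesis (ii) bounds
-- A(σ[i]) - A(τ[i] | B(τ[1,i-1])) by (c-d)·B(τ[i]), and hypothesis (i),
-- applied to τ, bounds A(τ[i] | B(τ[1,i-1])) by d·B(τ[i]).  Adding the two
-- inequalities cancels the conditional cost and gives A(σ[i]) ≤ c·B(τ[i]).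
-- Summing over i (sums are compatible with termwise bounds and with
-- scaling by c) yields A(σ) ≤ c·B(π(σ)).

open import Defs
open import Data.Nat using (ℕ; _≤_)
import Data.Nat as ℕ
open import Data.Fin using (Fin; zero; suc)
open import Data.Vec using (Vec)
open import Data.Rational using (ℚ; 0ℚ; 1ℚ; _+_; _-_; _*_; _<_; -_) renaming (_≤_ to _≤ℚ_)
open import Data.Rational.Properties
  using (+-assoc; +-inverseˡ; +-identityʳ; *-zeroʳ; *-distribˡ-+; *-distribʳ-+; +-mono-≤; ≤-refl)
open import Function.Bundles using (_⤖_; Bijection)
open import Relation.Binary.PropositionalEquality using (_≡_; refl; sym; cong; subst; module ≡-Reasoning)

minus-plus : ∀ a b → (a - b) + b ≡ a
minus-plus a b = begin
  (a - b) + b    ≡⟨ +-assoc a (- b) b ⟩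
  a + (- b + b)  ≡⟨ cong (a +_) (+-inverseˡ b) ⟩
  a + 0ℚ         ≡⟨ +-identityʳ a ⟩
  a              ∎
  where open ≡-Reasoning

telescope-bound : ∀ a b c d g → a - b ≤ℚ (c - d) * g → b ≤ℚ d * g → a ≤ℚ c * g
telescope-bound a b c d g a-b≤ b≤ =
  subst₂-≤ (minus-plus a b) coefficients (+-mono-≤ a-b≤ b≤)
  where
  coefficients : (c - d) * g + d * g ≡ c * g
  coefficients = begin
    (c - d) * g + d * g  ≡⟨ sym (*-distribʳ-+ g (c - d) d) ⟩
    ((c - d) + d) * g    ≡⟨ cong (_* g) (minus-plus c d) ⟩
    c * g                ∎
    where open ≡-Reasoning
  subst₂-≤ : ∀ {x x′ y y′} → x ≡ x′ → y ≡ y′ → x ≤ℚ y → x′ ≤ℚ y′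
  subst₂-≤ refl refl x≤y = x≤y

sumFin-scaled-bound : ∀ {n} (c : ℚ) (f g : Fin n → ℚ) →
                      (∀ i → f i ≤ℚ c * g i) → sumFin f ≤ℚ c * sumFin g
sumFin-scaled-bound {ℕ.zero} c f g _ = subst (0ℚ ≤ℚ_) (sym (*-zeroʳ c)) ≤-refl
sumFin-scaled-bound {ℕ.suc n} c f g f≤cg =
  subst (sumFin f ≤ℚ_) (sym (*-distribˡ-+ c (g zero) (sumFin (λ i → g (suc i)))))
    (+-mono-≤ (f≤cg zero)
      (sumFin-scaled-bound c (λ i → f (suc i)) (λ i → g (suc i)) (λ i → f≤cg (suc i))))

lemma4 : {m : ℕ} (M : FiniteMetric m) (k : ℕ) (C₀ : Vec (Fin m) k)
         (A : KServer.OnlineAlgorithm M k C₀) (B : KServer.Algorithm M k C₀)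
         (n : ℕ) → 1 ≤ n →
         (c d : ℚ) → 1ℚ < c → 0ℚ < d →
         (π : KServer.Inst M k C₀ n ⤖ KServer.Inst M k C₀ n) →
         (∀ (σ : KServer.Inst M k C₀ n) (i : Fin n) →
            KServer.onlineCondCost M k C₀ A σ i (KServer.confBefore M k C₀ B σ i)
              ≤ℚ d * KServer.reqCost M k C₀ B σ i) →
         (∀ (σ : KServer.Inst M k C₀ n) (i : Fin n) →
            KServer.onlineReqCost M k C₀ A σ i
              - KServer.onlineCondCost M k C₀ A (Bijection.to π σ) i
                  (KServer.confBefore M k C₀ B (Bijection.to π σ) i)
              ≤ℚ (c - d) * KServer.reqCost M k C₀ B (Bijection.to π σ) i) →
         ∀ (σ : KServer.Inst M k C₀ n) →
           KServer.onlineTotalCost M k C₀ A σ ≤ℚ c * KServer.totalCost M k C₀ B (Bijection.to π σ)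
lemma4 M k C₀ A B n _ c d _ _ π cond≤d excess≤c-d σ =
  sumFin-scaled-bound c (onlineReqCost A σ) (reqCost B τ) perRequest
  where
  open KServer M k C₀
  τ : Inst n
  τ = Bijection.to π σ
  -- A(σ[i]) ≤ c·B(τ[i]): combine (ii) at σ with (i) at τ.
  perRequest : ∀ i → onlineReqCost A σ i ≤ℚ c * reqCost B τ i
  perRequest i = telescope-bound _ _ c d _ (excess≤c-d σ i) (cond≤d τ i)
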